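{- Define the infinite matrix $M=(m_{j,k})_{j,k\ge1}$ of integers by: $m_{1,1}=8$, $m_{1,k}=0$ for $k\ge2$; $m_{2,1}=1$, $m_{2,2}=128$, $m_{2,k}=0$ for $k\ge3$; $m_{j,1}=0$ for $j\ge3$; and $m_{j,k}=16m_{j-1,k-1}+m_{j-2,k-1}$ for $j\ge3$, $k\ge2$. For an integer $n$, let $\vartheta_2(n)$ be the exponent of the highest power of $2$ dividing $n$, with $\vartheta_2(0)=+\infty$. Then for all integers $j,k\ge1$ with $k\le j\le 2k$, \[\vartheta_2(m_{j,k})\ge 4(2k-j)-1.\] -}

module Defs where

open import Data.Nat using (ℕ; zero; suc; _^_)
open import Data.Integer using (ℤ; +_; _+_; _*_; _≤_)
open import Data.Integer.Divisibility using (_∣_)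

-- m j k for 1-indexed j,k ≥ 1 (we use the 1-based indices directly;
-- row/column index 0 is unused and set to 0).
m : ℕ → ℕ → ℤ
m (suc zero) (suc zero) = + 8
m (suc zero) _ = + 0
m (suc (suc zero)) (suc zero) = + 1
m (suc (suc zero)) (suc (suc zero)) = + 128
m (suc (suc zero)) _ = + 0
m (suc (suc (suc j))) (suc zero) = + 0
m (suc (suc (suc j))) (suc (suc k)) =
  + 16 * m (suc (suc j)) (suc k) + m (suc j) (suc k)
m _ _ = + 0

-- "ϑ₂(n) ≥ t" for an integer t, where ϑ₂ is the 2-adic valuation with
-- ϑ₂(0) = +∞: every natural e ≤ t has 2^e ∣ n.
ϑ₂≥ : ℤ → ℤ → Set
ϑ₂≥ n t = ∀ (e : ℕ) → + e ≤ t → + (2 ^ e) ∣ n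

-- Split the recursion as m(j+3,k+2) = 16·m(j+2,k+1) + m(j+1,k+1) and let
-- ν(j,k) = 8k − 4j − 1, truncated at 0.  Passing to m(j+1,k+1) leaves ν
-- unchanged, while passing to m(j+2,k+1) lowers it by at most 4, which the
-- factor 16 = 2⁴ makes up for; the initial values 8 = 2³ and 128 = 2⁷ meet
-- the bound exactly.  So 2^ν(j,k) divides every entry by induction, with no
-- need for the range k ≤ j ≤ 2k.
module Submission where

open import Defs
open import Data.Nat using (ℕ; _≤_; _*_)
open import Data.Integer using (+_; _-_)
open import Data.Integer as ℤ using ()

open import Data.Nat using (zero; suc; _+_; _∸_; _^_; z≤n; s≤s)
open import Data.Nat.Properties
  using (*-suc; *-distribˡ-+; +-comm; [m+n]∸[m+o]≡n∸o; m∸n≤m; ^-distribˡ-+-*; ≤-refl; module ≤-Reasoning)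
open import Data.Nat.Divisibility as ℕ∣ using (_∣0; 1∣_; *-monoʳ-∣)
open import Data.Integer using (ℤ; _⊖_)
open import Data.Integer.Properties using (pos-*; [+m]-[+n]≡m⊖n; [1+m]⊖[1+n]≡m⊖n; ⊖-≥; drop‿+≤+)
open import Data.Integer.Divisibility.Signed as ℤ∣ using (_∣_; ∣ᵤ⇒∣; ∣⇒∣ᵤ; ∣-refl; ∣-trans; ∣m∣n⇒∣m+n)
open import Data.Integer.Tactic.RingSolver using (solve-∀)
open import Relation.Binary.PropositionalEquality using (_≡_; sym; trans; cong; cong₂; subst; module ≡-Reasoning)

^-monoʳ-∣ : ∀ b {n o} → n ≤ o → b ^ n ℕ∣.∣ b ^ o
^-monoʳ-∣ b {o = o} z≤n = 1∣ (b ^ o)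
^-monoʳ-∣ b (s≤s n≤o) = *-monoʳ-∣ b (^-monoʳ-∣ b n≤o)

+≤⊖⇒≤∸ : ∀ {e} m n → + e ℤ.≤ m ⊖ n → e ≤ m ∸ n
+≤⊖⇒≤∸ {e} m       zero    e≤m⊖0 = drop‿+≤+ (subst (+ e ℤ.≤_) (⊖-≥ z≤n) e≤m⊖0)
+≤⊖⇒≤∸     zero    (suc n) ()
+≤⊖⇒≤∸ {e} (suc m) (suc n) e≤m⊖n = +≤⊖⇒≤∸ m n (subst (+ e ℤ.≤_) ([1+m]⊖[1+n]≡m⊖n m n) e≤m⊖n)

ν : ℕ → ℕ → ℕ
ν j k = 8 * k ∸ suc (4 * j)

ν-shift : ∀ j k → ν (suc (suc j)) (suc k) ≡ ν j k
ν-shift j k = begin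
  8 * suc k ∸ suc (4 * (2 + j))   ≡⟨ cong₂ (λ a b → a ∸ suc b) (*-suc 8 k) (*-distribˡ-+ 4 2 j) ⟩
  (8 + 8 * k) ∸ (8 + suc (4 * j)) ≡⟨ [m+n]∸[m+o]≡n∸o 8 (8 * k) (suc (4 * j)) ⟩
  ν j k                           ∎
  where open ≡-Reasoning

[m+n]∸o≤[m∸o]+n : ∀ m n o → (m + n) ∸ o ≤ (m ∸ o) + n
[m+n]∸o≤[m∸o]+n m       n zero    = ≤-refl
[m+n]∸o≤[m∸o]+n zero    n (suc o) = m∸n≤m n (suc o)
[m+n]∸o≤[m∸o]+n (suc m) n (suc o) = [m+n]∸o≤[m∸o]+n m n o

ν-diagonal : ∀ j k → ν (suc j) (suc k) ≤ 4 + ν j k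
ν-diagonal j k = begin
  8 * suc k ∸ suc (4 * suc j)  ≡⟨ cong₂ (λ a b → a ∸ suc b) (*-suc 8 k) (*-suc 4 j) ⟩
  (4 + 8 * k) ∸ suc (4 * j)    ≡⟨ cong (_∸ suc (4 * j)) (+-comm 4 (8 * k)) ⟩
  (8 * k + 4) ∸ suc (4 * j)    ≤⟨ [m+n]∸o≤[m∸o]+n (8 * k) 4 (suc (4 * j)) ⟩
  ν j k + 4                    ≡⟨ +-comm (ν j k) 4 ⟩
  4 + ν j k                    ∎
  where open ≤-Reasoning

ν-bound : ∀ {e} j k → + e ℤ.≤ + 4 ℤ.* (+ (2 * k) - + j) - + 1 → e ≤ ν j k
ν-bound {e} j k e≤bound = +≤⊖⇒≤∸ (8 * k) (suc (4 * j)) (subst (+ e ℤ.≤_) bound≡ e≤bound)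
  where
  rearrange : ∀ a b → + 4 ℤ.* (+ 2 ℤ.* a - b) - + 1 ≡ + 8 ℤ.* a - (+ 1 ℤ.+ + 4 ℤ.* b)
  rearrange = solve-∀
  open ≡-Reasoning
  bound≡ : + 4 ℤ.* (+ (2 * k) - + j) - + 1 ≡ 8 * k ⊖ suc (4 * j)
  bound≡ = begin
    + 4 ℤ.* (+ (2 * k) - + j) - + 1        ≡⟨ cong (λ a → + 4 ℤ.* (a - + j) - + 1) (pos-* 2 k) ⟩
    + 4 ℤ.* (+ 2 ℤ.* + k - + j) - + 1      ≡⟨ rearrange (+ k) (+ j) ⟩
    + 8 ℤ.* + k - (+ 1 ℤ.+ + 4 ℤ.* + j)    ≡⟨ cong₂ _-_ (sym (pos-* 8 k)) (cong (ℤ._+_ (+ 1)) (sym (pos-* 4 j))) ⟩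
    + (8 * k) - + suc (4 * j)              ≡⟨ [+m]-[+n]≡m⊖n (8 * k) (suc (4 * j)) ⟩
    8 * k ⊖ suc (4 * j)                    ∎

b^e∣b^n*x : ∀ b {e n f} {x : ℤ} → e ≤ n + f → + (b ^ f) ∣ x → + (b ^ e) ∣ + (b ^ n) ℤ.* x
b^e∣b^n*x b {e} {n} {f} {x} e≤n+f bᶠ∣x =
  ∣-trans (∣ᵤ⇒∣ (^-monoʳ-∣ b e≤n+f)) (subst (_∣ + (b ^ n) ℤ.* x) bⁿ*bᶠ≡bⁿ⁺ᶠ (ℤ∣.*-monoʳ-∣ (+ (b ^ n)) bᶠ∣x))
  where
  bⁿ*bᶠ≡bⁿ⁺ᶠ : + (b ^ n) ℤ.* + (b ^ f) ≡ + (b ^ (n + f))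
  bⁿ*bᶠ≡bⁿ⁺ᶠ = trans (sym (pos-* (b ^ n) (b ^ f))) (cong +_ (sym (^-distribˡ-+-* b n f)))

∣+0 : ∀ {i} → i ∣ + 0
∣+0 = ∣ᵤ⇒∣ (_ ∣0)

2^ν∣m : ∀ j k → + (2 ^ ν j k) ∣ m j k
2^ν∣m 0 k = ∣+0
2^ν∣m 1 0 = ∣+0
2^ν∣m 1 1 = ∣-refl
2^ν∣m 1 (suc (suc k)) = ∣+0
2^ν∣m 2 0 = ∣+0
2^ν∣m 2 1 = ∣-refl
2^ν∣m 2 2 = ∣-refl
2^ν∣m 2 (suc (suc (suc k))) = ∣+0
2^ν∣m (suc (suc (suc j))) 0 = ∣+0
2^ν∣m (suc (suc (suc j))) 1 = ∣+0
2^ν∣m (suc (suc (suc j))) (suc (suc k)) = ∣m∣n⇒∣m+n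
  (b^e∣b^n*x 2 {n = 4} (ν-diagonal (suc (suc j)) (suc k)) (2^ν∣m (suc (suc j)) (suc k)))
  (subst (λ e → + (2 ^ e) ∣ m (suc j) (suc k)) (sym (ν-shift (suc j) (suc k))) (2^ν∣m (suc j) (suc k)))

lemma4p1 : (j k : ℕ) → 1 ≤ j → 1 ≤ k → k ≤ j → j ≤ 2 * k →
    ϑ₂≥ (m j k) (+ 4 ℤ.* (+ (2 * k) - + j) - + 1)
lemma4p1 j k _ _ _ _ e e≤bound = ℕ∣.∣-trans (^-monoʳ-∣ 2 (ν-bound j k e≤bound)) (∣⇒∣ᵤ (2^ν∣m j k))
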